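{- Let $\mathcal N$ be the set of (weakly) $\beta$-normalising terms and let $\mathcal I:\mathcal A\to\mathcal P(\mathcal M)$ be given by $\mathcal I(a)=\mathcal N$ for all $a\in\mathcal A$. Then: (1) $\mathcal I$ is a $\beta$-interpretation (i.e. each $\mathcal I(a)$ is $\beta$-saturated); extend it to $\mathbb U$ as for any $\beta$-interpretation; (2) if $U\in\mathbb U^+$ then $\mathcal I(U)\subseteq\mathcal N$; (3) letting $\mathcal N'=\{xM_1\dots M_n\in\mathcal M\mid x\in\mathcal V,\ n\ge0,\ M_1,\dots,M_n\in\mathcal N\}$ (note $\mathcal N'\subseteq\mathcal N$), if $U\in\mathbb U^-$ then $\mathcal N'\subseteq\mathcal I(U)$.
   Context: Terms: $\mathcal V$ is a denumerably infinite set of variables; $\mathcal M$ is the set of untyped $\lambda$-terms $M::=x\mid \lambda x.M\mid MM$ taken modulo $\alpha$-conversion. $\rhd_\beta$ is the compatible closure of $(\lambda x.M)N\rhd_\beta M[x:=N]$ and $\rhd_\beta^*$ its reflexive-transitive closure; a term is $\beta$-normalising if it $\beta$-reduces to a $\beta$-normal form. Types: $\mathcal A$ is a denumerably infinite set of atomic types; $\mathbb T::=a\mid \mathbb U\to\mathbb T$ ($a\in\mathcal A$) and $\mathbb U::=\omega\mid \mathbb U\sqcap\mathbb U\mid \mathbb T$; types are quotiented by commutativity, associativity and idempotence of $\sqcap$ and by $\omega\sqcap U=U$. The subsets $\mathbb U^+,\mathbb U^-\subseteq\mathbb U$ are defined simultaneously: every $a\in\mathcal A$ is in both; $\omega\in\mathbb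 U^-$; if $U\in\mathbb U^+$ then $U\sqcap V\in\mathbb U^+$ (any $V$); if $U,V\in\mathbb U^-$ then $U\sqcap V\in\mathbb U^-$; if $U\in\mathbb U^-$ and $T\in\mathbb U^+$ (with $T\in\mathbb T$) then $U\to T\in\mathbb U^+$; if $U\in\mathbb U^+$ and $T\in\mathbb U^-$ then $U\to T\in\mathbb U^-$. Semantics: for $\mathcal X,\mathcal Y\subseteq\mathcal M$, $\mathcal X\leadsto\mathcal Y=\{M\in\mathcal M\mid MN\in\mathcal Y\text{ for all }N\in\mathcal X\}$. $\mathcal X$ is $\beta$-saturated if $M\rhd_\beta^*N$ and $N\in\mathcal X$ imply $M\in\mathcal X$. A $\beta$-interpretation is a function $\mathcal I:\mathcal A\to\mathcal P(\mathcal M)$ with every $\mathcal I(a)$ $\beta$-saturated, extended to $\mathbb U$ by $\mathcal I(\omega)=\mathcal M$, $\mathcal I(U_1\sqcap U_2)=\mathcal I(U_1)\cap\mathcal I(U_2)$, $\mathcal I(U\to T)=\mathcal I(U)\leadsto\mathcal I(T)$. -}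

module Defs where

open import Data.Nat using (ℕ; zero; suc)
open import Data.List using (List; []; _∷_; foldl)
open import Data.List.Relation.Unary.All using (All)
open import Data.Product using (Σ; ∃; ∃-syntax; _×_; _,_)
open import Relation.Nullary using (¬_)
open import Relation.Unary using (Pred; _∩_; U)
open import Relation.Binary.PropositionalEquality using (_≡_)
open import Relation.Binary.Construct.Closure.ReflexiveTransitive using (Star)
open import Level using (0ℓ)

-- Untyped λ-terms modulo α-conversion: de Bruijn representation.
-- Variables 𝒱 are the indices ℕ (denumerably infinite).

data Term : Set where
  var : ℕ → Term
  lam : Term → Term
  app : Term → Term → Term

ext : (ℕ → ℕ) → ℕ → ℕ
ext ρ zero    = zero
ext ρ (suc n) = suc (ρ n)

rename : (ℕ → ℕ) → Term → Term
rename ρ (var x)   = var (ρ x)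
rename ρ (lam M)   = lam (rename (ext ρ) M)
rename ρ (app M N) = app (rename ρ M) (rename ρ N)

exts : (ℕ → Term) → ℕ → Term
exts σ zero    = var zero
exts σ (suc n) = rename suc (σ n)

sub : (ℕ → Term) → Term → Term
sub σ (var x)   = σ x
sub σ (lam M)   = lam (sub (exts σ) M)
sub σ (app M N) = app (sub σ M) (sub σ N)

sub0 : Term → ℕ → Term
sub0 N zero    = N
sub0 N (suc n) = var n

-- M [ N ] is M[x:=N] where x is the variable bound by the enclosing λ.
_[_] : Term → Term → Term
M [ N ] = sub (sub0 N) M

infix 4 _▷β_
data _▷β_ : Term → Term → Set where
  β    : ∀ {M N} → app (lam M) N ▷β M [ N ]
  ξlam : ∀ {M M'} → M ▷β M' → lam M ▷β lam M'
  ξl   : ∀ {M M' N} → M ▷β M' → app M N ▷β app M' N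
  ξr   : ∀ {M N N'} → N ▷β N' → app M N ▷β app M N'

_▷β*_ : Term → Term → Set
_▷β*_ = Star _▷β_

BetaNormal : Term → Set
BetaNormal M = ¬ (∃[ N ] (M ▷β N))

𝒩 : Pred Term 0ℓ
𝒩 M = ∃[ N ] (M ▷β* N × BetaNormal N)

apps : Term → List Term → Term
apps = foldl app

𝒩' : Pred Term 0ℓ
𝒩' M = ∃[ x ] ∃[ Ms ] (All 𝒩 Ms × M ≡ apps (var x) Ms)

BetaSaturated : Pred Term 0ℓ → Set
BetaSaturated X = ∀ {M N} → M ▷β* N → X N → X M

_⇝_ : Pred Term 0ℓ → Pred Term 0ℓ → Pred Term 0ℓ
(X ⇝ Y) M = ∀ N → X N → Y (app M N)

-- Types.  Atomic types 𝒜 = ℕ.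
--   𝕋 ::= a | 𝕌 → 𝕋       𝕌 ::= ω | 𝕌 ⊓ 𝕌 | 𝕋
-- Quotienting is modelled by an explicit congruence _≈U_/_≈T_.

Atom : Set
Atom = ℕ

mutual
  data TTy : Set where
    atom : Atom → TTy
    _⇒_  : UTy → TTy → TTy

  data UTy : Set where
    ω   : UTy
    _⊓_ : UTy → UTy → UTy
    ⌊_⌋ : TTy → UTy

infixr 7 _⇒_
infixl 8 _⊓_

mutual
  data _≈U_ : UTy → UTy → Set where
    ≈U-refl  : ∀ {A} → A ≈U A
    ≈U-sym   : ∀ {A B} → A ≈U B → B ≈U A
    ≈U-trans : ∀ {A B C} → A ≈U B → B ≈U C → A ≈U C
    ⊓-comm   : ∀ {A B} → (A ⊓ B) ≈U (B ⊓ A)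
    ⊓-assoc  : ∀ {A B C} → ((A ⊓ B) ⊓ C) ≈U (A ⊓ (B ⊓ C))
    ⊓-idem   : ∀ {A} → (A ⊓ A) ≈U A
    ⊓-unit   : ∀ {A} → (ω ⊓ A) ≈U A
    ⊓-cong   : ∀ {A A' B B'} → A ≈U A' → B ≈U B' → (A ⊓ B) ≈U (A' ⊓ B')
    ⌊⌋-cong  : ∀ {T T'} → T ≈T T' → ⌊ T ⌋ ≈U ⌊ T' ⌋

  data _≈T_ : TTy → TTy → Set where
    ≈T-refl  : ∀ {T} → T ≈T T
    ≈T-sym   : ∀ {T T'} → T ≈T T' → T' ≈T T
    ≈T-trans : ∀ {T T' T''} → T ≈T T' → T' ≈T T'' → T ≈T T''
    ⇒-cong   : ∀ {A A' T T'} → A ≈U A' → T ≈T T' → (A ⇒ T) ≈T (A' ⇒ T')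

-- 𝕌⁺ and 𝕌⁻ (on equivalence classes: closed under _≈U_).
mutual
  data Pos : UTy → Set where
    pos-atom : ∀ a → Pos ⌊ atom a ⌋
    pos-⊓    : ∀ {A} B → Pos A → Pos (A ⊓ B)
    pos-⇒    : ∀ {A T} → Neg A → Pos ⌊ T ⌋ → Pos ⌊ A ⇒ T ⌋
    pos-≈    : ∀ {A B} → A ≈U B → Pos A → Pos B

  data Neg : UTy → Set where
    neg-atom : ∀ a → Neg ⌊ atom a ⌋
    neg-ω    : Neg ω
    neg-⊓    : ∀ {A B} → Neg A → Neg B → Neg (A ⊓ B)
    neg-⇒    : ∀ {A T} → Pos A → Neg ⌊ T ⌋ → Neg ⌊ A ⇒ T ⌋
    neg-≈    : ∀ {A B} → A ≈U B → Neg A → Neg B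

IsBetaInterpretation : (Atom → Pred Term 0ℓ) → Set
IsBetaInterpretation I = ∀ a → BetaSaturated (I a)

mutual
  ⟦_⟧U : UTy → (Atom → Pred Term 0ℓ) → Pred Term 0ℓ
  ⟦ ω ⟧U     I = U
  ⟦ A ⊓ B ⟧U I = ⟦ A ⟧U I ∩ ⟦ B ⟧U I
  ⟦ ⌊ T ⌋ ⟧U I = ⟦ T ⟧T I

  ⟦_⟧T : TTy → (Atom → Pred Term 0ℓ) → Pred Term 0ℓ
  ⟦ atom a ⟧T I = I a
  ⟦ A ⇒ T ⟧T  I = ⟦ A ⟧U I ⇝ ⟦ T ⟧T I

I𝒩 : Atom → Pred Term 0ℓ
I𝒩 _ = 𝒩

module Submission where

-- Saturation is immediate: prefix the normalising reduction.  Parts (2) and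
-- (3) are proved by a simultaneous induction on the derivations of Pos and
-- Neg, for any interpretation I with  𝒩' ⊆ I a ⊆ 𝒩.  The two interesting
-- cases are the arrows:
--   * M ∈ ⟦U → T⟧ with U negative: the variable x lies in 𝒩' ⊆ ⟦U⟧, so
--     M x ∈ ⟦T⟧ ⊆ 𝒩, and  M x ∈ 𝒩  implies  M ∈ 𝒩  (𝒩-app-var);
--   * M ∈ 𝒩' and N ∈ ⟦U⟧ ⊆ 𝒩 with U positive: then M N ∈ 𝒩' again.
-- The fact  M x ∈ 𝒩 ⇒ M ∈ 𝒩  needs that renamings reflect normalisation,
-- which rests on the usual de Bruijn renaming/substitution algebra developed
-- first.  The quotient of types is handled by showing that the semantics of
-- types is invariant under the congruence ≈ for every interpretation.

open import Defs
open import Data.Nat using (ℕ; zero; suc)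
open import Data.Product using (_×_; ∃-syntax; _,_; proj₁; proj₂)
open import Data.List using ([]; _∷_; _++_)
open import Data.List.Properties using (foldl-++)
open import Data.List.Relation.Unary.All using (All; []; _∷_)
open import Data.List.Relation.Unary.All.Properties using (++⁺)
open import Data.Unit using (tt)
open import Function using (id)
open import Level using (0ℓ)
open import Relation.Unary using (Pred; _⊆_; _≐_)
open import Relation.Unary.Properties using (≐-refl; ≐-sym; ≐-trans)
open import Relation.Binary.PropositionalEquality
  using (_≡_; refl; sym; trans; cong; cong₂; subst; module ≡-Reasoning)
open import Relation.Binary.Construct.Closure.ReflexiveTransitive
  using (ε; _◅_; _◅◅_; gmap)

rename-cong : ∀ {ρ ρ'} → (∀ n → ρ n ≡ ρ' n) → ∀ M → rename ρ M ≡ rename ρ' M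
rename-cong e (var x)   = cong var (e x)
rename-cong {ρ} {ρ'} e (lam M) = cong lam (rename-cong ext-cong M)
  where
    ext-cong : ∀ n → ext ρ n ≡ ext ρ' n
    ext-cong zero    = refl
    ext-cong (suc n) = cong suc (e n)
rename-cong e (app M N) = cong₂ app (rename-cong e M) (rename-cong e N)

sub-cong : ∀ {σ τ} → (∀ n → σ n ≡ τ n) → ∀ M → sub σ M ≡ sub τ M
sub-cong e (var x)   = e x
sub-cong {σ} {τ} e (lam M) = cong lam (sub-cong exts-cong M)
  where
    exts-cong : ∀ n → exts σ n ≡ exts τ n
    exts-cong zero    = refl
    exts-cong (suc n) = cong (rename suc) (e n)
sub-cong e (app M N) = cong₂ app (sub-cong e M) (sub-cong e N)

rename-rename : ∀ ρ ρ' M → rename ρ (rename ρ' M) ≡ rename (λ n → ρ (ρ' n)) M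
rename-rename ρ ρ' (var x)   = refl
rename-rename ρ ρ' (lam M)   =
  cong lam (trans (rename-rename (ext ρ) (ext ρ') M) (rename-cong ext-ext M))
  where
    ext-ext : ∀ n → ext ρ (ext ρ' n) ≡ ext (λ k → ρ (ρ' k)) n
    ext-ext zero    = refl
    ext-ext (suc n) = refl
rename-rename ρ ρ' (app M N) = cong₂ app (rename-rename ρ ρ' M) (rename-rename ρ ρ' N)

rename-sub : ∀ ρ σ M → rename ρ (sub σ M) ≡ sub (λ n → rename ρ (σ n)) M
rename-sub ρ σ (var x)   = refl
rename-sub ρ σ (lam M)   =
  cong lam (trans (rename-sub (ext ρ) (exts σ) M) (sub-cong ext-exts M))
  where
    ext-exts : ∀ n → rename (ext ρ) (exts σ n) ≡ exts (λ k → rename ρ (σ k)) n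
    ext-exts zero    = refl
    ext-exts (suc n) = trans (rename-rename (ext ρ) suc (σ n))
                             (sym (rename-rename suc ρ (σ n)))
rename-sub ρ σ (app M N) = cong₂ app (rename-sub ρ σ M) (rename-sub ρ σ N)

sub-rename : ∀ σ ρ M → sub σ (rename ρ M) ≡ sub (λ n → σ (ρ n)) M
sub-rename σ ρ (var x)   = refl
sub-rename σ ρ (lam M)   =
  cong lam (trans (sub-rename (exts σ) (ext ρ) M) (sub-cong exts-ext M))
  where
    exts-ext : ∀ n → exts σ (ext ρ n) ≡ exts (λ k → σ (ρ k)) n
    exts-ext zero    = refl
    exts-ext (suc n) = refl
sub-rename σ ρ (app M N) = cong₂ app (sub-rename σ ρ M) (sub-rename σ ρ N)

sub-var : ∀ ρ M → sub (λ n → var (ρ n)) M ≡ rename ρ M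
sub-var ρ (var x)   = refl
sub-var ρ (lam M)   = cong lam (trans (sub-cong exts-var M) (sub-var (ext ρ) M))
  where
    exts-var : ∀ n → exts (λ k → var (ρ k)) n ≡ var (ext ρ n)
    exts-var zero    = refl
    exts-var (suc n) = refl
sub-var ρ (app M N) = cong₂ app (sub-var ρ M) (sub-var ρ N)

rename-[] : ∀ ρ M N → rename (ext ρ) M [ rename ρ N ] ≡ rename ρ (M [ N ])
rename-[] ρ M N = begin
  sub (sub0 (rename ρ N)) (rename (ext ρ) M)    ≡⟨ sub-rename _ (ext ρ) M ⟩
  sub (λ n → sub0 (rename ρ N) (ext ρ n)) M     ≡⟨ sub-cong sub0-ext M ⟩
  sub (λ n → rename ρ (sub0 N n)) M             ≡⟨ sym (rename-sub ρ (sub0 N) M) ⟩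
  rename ρ (sub (sub0 N) M)                     ∎
  where
    open ≡-Reasoning
    sub0-ext : ∀ n → sub0 (rename ρ N) (ext ρ n) ≡ rename ρ (sub0 N n)
    sub0-ext zero    = refl
    sub0-ext (suc n) = refl

instantiate : ℕ → ℕ → ℕ
instantiate x zero    = x
instantiate x (suc n) = n

[var]≡rename : ∀ M x → M [ var x ] ≡ rename (instantiate x) M
[var]≡rename M x = trans (sub-cong sub0-var M) (sub-var (instantiate x) M)
  where
    sub0-var : ∀ n → sub0 (var x) n ≡ var (instantiate x n)
    sub0-var zero    = refl
    sub0-var (suc n) = refl

rename-step : ∀ ρ {P Q} → P ▷β Q → rename ρ P ▷β rename ρ Q
rename-step ρ (β {M} {N}) = subst (rename ρ (app (lam M) N) ▷β_) (rename-[] ρ M N) β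
rename-step ρ (ξlam s)    = ξlam (rename-step (ext ρ) s)
rename-step ρ (ξl s)      = ξl (rename-step ρ s)
rename-step ρ (ξr s)      = ξr (rename-step ρ s)

rename-step⁻¹ : ∀ ρ P {Q} → rename ρ P ▷β Q → ∃[ P' ] (P ▷β P' × rename ρ P' ≡ Q)
rename-step⁻¹ ρ (var x) ()
rename-step⁻¹ ρ (lam M) (ξlam s) with rename-step⁻¹ (ext ρ) M s
... | M' , s' , refl = lam M' , ξlam s' , refl
rename-step⁻¹ ρ (app (lam M) N) β = M [ N ] , β , sym (rename-[] ρ M N)
rename-step⁻¹ ρ (app M N) (ξl s) with rename-step⁻¹ ρ M s
... | M' , s' , refl = app M' N , ξl s' , refl
rename-step⁻¹ ρ (app M N) (ξr s) with rename-step⁻¹ ρ N s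
... | N' , s' , refl = app M N' , ξr s' , refl

rename-normal⁻¹ : ∀ ρ P → BetaNormal (rename ρ P) → BetaNormal P
rename-normal⁻¹ ρ P nf (R , s) = nf (rename ρ R , rename-step ρ s)

rename-𝒩⁻¹ : ∀ ρ P {N} → rename ρ P ▷β* N → BetaNormal N → 𝒩 P
rename-𝒩⁻¹ ρ P ε        nf = P , ε , rename-normal⁻¹ ρ P nf
rename-𝒩⁻¹ ρ P (s ◅ ss) nf with rename-step⁻¹ ρ P s
... | P' , s' , refl with rename-𝒩⁻¹ ρ P' ss nf
...   | R , rs , nfR = R , s' ◅ rs , nfR

𝒩-saturated : BetaSaturated 𝒩
𝒩-saturated r (R , rs , nf) = R , r ◅◅ rs , nf

lam-𝒩 : ∀ {M} → 𝒩 M → 𝒩 (lam M)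
lam-𝒩 (R , rs , nf) = lam R , gmap lam ξlam rs , λ { (_ , ξlam s) → nf (_ , s) }

-- If  M x  normalises then so does M: a normalising reduction of  M x
-- either never contracts the head redex (and then M reaches a normal form
-- alongside), or M reduces to some  λP  and  P[x]  normalises, which is a
-- renaming of P.
𝒩-app-var : ∀ {M x N} → app M (var x) ▷β* N → BetaNormal N → 𝒩 M
𝒩-app-var {M} ε nf = M , ε , λ { (_ , s) → nf (_ , ξl s) }
𝒩-app-var (ξl s ◅ ss) nf with 𝒩-app-var ss nf
... | R , rs , nfR = R , s ◅ rs , nfR
𝒩-app-var (ξr () ◅ ss) nf
𝒩-app-var {lam P} {x} (β ◅ ss) nf =
  lam-𝒩 (rename-𝒩⁻¹ (instantiate x) P (subst (_▷β* _) ([var]≡rename P x) ss) nf)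

data Neutral : Term → Set where
  nvar : ∀ x → Neutral (var x)
  napp : ∀ {M N} → Neutral M → Neutral (app M N)

neutral-app-normal : ∀ {H M} → Neutral H → BetaNormal H → BetaNormal M →
                     BetaNormal (app H M)
neutral-app-normal ()  _  _  (_ , β)
neutral-app-normal _   nH _  (_ , ξl s) = nH (_ , s)
neutral-app-normal _   _  nM (_ , ξr s) = nM (_ , s)

apps-reduce-head : ∀ {H H'} Ms → H ▷β* H' → apps H Ms ▷β* apps H' Ms
apps-reduce-head []       r = r
apps-reduce-head (M ∷ Ms) r = apps-reduce-head Ms (gmap (λ H → app H M) ξl r)

neutral-apps-𝒩 : ∀ {H} Ms → Neutral H → BetaNormal H → All 𝒩 Ms → 𝒩 (apps H Ms)
neutral-apps-𝒩 {H} [] _ nH [] = H , ε , nH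
neutral-apps-𝒩 {H} (M ∷ Ms) n nH ((M' , rs , nM') ∷ ns)
  with neutral-apps-𝒩 Ms (napp n) (neutral-app-normal n nH nM') ns
... | R , rs' , nfR = R , apps-reduce-head Ms (gmap (app H) ξr rs) ◅◅ rs' , nfR

𝒩'⊆𝒩 : 𝒩' ⊆ 𝒩
𝒩'⊆𝒩 (x , Ms , ns , refl) = neutral-apps-𝒩 Ms (nvar x) (λ ()) ns

𝒩'-app : ∀ {M N} → 𝒩' M → 𝒩 N → 𝒩' (app M N)
𝒩'-app {N = N} (x , Ms , ns , refl) nN =
  x , Ms ++ N ∷ [] , ++⁺ ns (nN ∷ []) , sym (foldl-++ app (var x) Ms (N ∷ []))

mutual
  ≈U-sound : ∀ I {A B} → A ≈U B → ⟦ A ⟧U I ≐ ⟦ B ⟧U I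
  ≈U-sound I ≈U-refl        = ≐-refl
  ≈U-sound I (≈U-sym e)     = ≐-sym (≈U-sound I e)
  ≈U-sound I (≈U-trans e f) = ≐-trans (≈U-sound I e) (≈U-sound I f)
  ≈U-sound I ⊓-comm         = (λ (a , b) → b , a) , (λ (a , b) → b , a)
  ≈U-sound I ⊓-assoc        = (λ ((a , b) , c) → a , (b , c))
                            , (λ (a , (b , c)) → (a , b) , c)
  ≈U-sound I ⊓-idem         = proj₁ , λ a → a , a
  ≈U-sound I ⊓-unit         = proj₂ , λ a → tt , a
  ≈U-sound I (⊓-cong e f)   =
    (λ (a , b) → proj₁ (≈U-sound I e) a , proj₁ (≈U-sound I f) b) ,
    (λ (a , b) → proj₂ (≈U-sound I e) a , proj₂ (≈U-sound I f) b)
  ≈U-sound I (⌊⌋-cong e)    = ≈T-sound I e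

  ≈T-sound : ∀ I {T T'} → T ≈T T' → ⟦ T ⟧T I ≐ ⟦ T' ⟧T I
  ≈T-sound I ≈T-refl        = ≐-refl
  ≈T-sound I (≈T-sym e)     = ≐-sym (≈T-sound I e)
  ≈T-sound I (≈T-trans e f) = ≐-trans (≈T-sound I e) (≈T-sound I f)
  ≈T-sound I (⇒-cong e f)   =
    (λ m N n → proj₁ (≈T-sound I f) (m N (proj₂ (≈U-sound I e) n))) ,
    (λ m N n → proj₂ (≈T-sound I f) (m N (proj₁ (≈U-sound I e) n)))

module Bounds (I : Atom → Pred Term 0ℓ)
              (I⊆𝒩 : ∀ a → I a ⊆ 𝒩) (𝒩'⊆I : ∀ a → 𝒩' ⊆ I a) where

  mutual
    positive⊆𝒩 : ∀ A → Pos A → ⟦ A ⟧U I ⊆ 𝒩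
    positive⊆𝒩 _ (pos-atom a)        m = I⊆𝒩 a m
    positive⊆𝒩 _ (pos-⊓ {A} _ p)     m = positive⊆𝒩 A p (proj₁ m)
    positive⊆𝒩 _ (pos-⇒ {A} {T} n p) m
      with positive⊆𝒩 ⌊ T ⌋ p (m (var 0) (𝒩'⊆negative A n (0 , [] , [] , refl)))
    ... | _ , rs , nf = 𝒩-app-var rs nf
    positive⊆𝒩 _ (pos-≈ {A} e p)     m = positive⊆𝒩 A p (proj₂ (≈U-sound I e) m)

    𝒩'⊆negative : ∀ A → Neg A → 𝒩' ⊆ ⟦ A ⟧U I
    𝒩'⊆negative _ (neg-atom a)         m = 𝒩'⊆I a m
    𝒩'⊆negative _ neg-ω                m = tt
    𝒩'⊆negative _ (neg-⊓ {A} {B} n n') m = 𝒩'⊆negative A n m , 𝒩'⊆negative B n' m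
    𝒩'⊆negative _ (neg-⇒ {A} {T} p n)  m N nN =
      𝒩'⊆negative ⌊ T ⌋ n (𝒩'-app m (positive⊆𝒩 A p nN))
    𝒩'⊆negative _ (neg-≈ {A} e n)      m = proj₁ (≈U-sound I e) (𝒩'⊆negative A n m)

lemma5p11 : IsBetaInterpretation I𝒩
    × (∀ (A : UTy) → Pos A → ⟦ A ⟧U I𝒩 ⊆ 𝒩)
    × (∀ (A : UTy) → Neg A → 𝒩' ⊆ ⟦ A ⟧U I𝒩)
lemma5p11 = (λ _ → 𝒩-saturated) , positive⊆𝒩 , 𝒩'⊆negative
  where open Bounds I𝒩 (λ _ → id) (λ _ → 𝒩'⊆𝒩)
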